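{- Let $M$ be a system F term and $t$ a regular pseudo-term. Then $t^-=M$ (i.e. $t$ is a decoration of $M$) if and only if there is an instantiation $\phi$ admissible for the free decoration $\widehat{M}$ of $M$ such that $\phi(\widehat{M})=t$.
   Context: System F types $T::=\alpha\mid T\rightarrow U\mid\forall\alpha.T$, Church-style terms $x^T,\lambda x^T.M,(M)N,\Lambda\alpha.M,(M)T$. DLAL$\star$ types: linear $A::=\alpha\mid D\multimap A\mid\forall\alpha.A\mid\S A$, and $D::=A\mid !A$. Pseudo-terms: $t::=x^D\mid\lambda x^D.t\mid(t)u\mid\Lambda\alpha.t\mid(t)A\mid\S t\mid\bar\S t$ ($A$ linear); $\S^m t$ denotes $m$ copies of $\S$ if $m\ge0$ and $-m$ copies of $\bar\S$ if $m<0$. The erasure $(\cdot)^-$ removes all $\S,\bar\S,!$ and turns $\multimap$ into $\rightarrow$ (in annotations too). A pseudo-term is regular if it has no subterm $\S\bar\S u$ or $\bar\S\S u$. Parameters: integer parameters $\mathsf{m},\mathsf{n},\ldots$ and boolean parameters $\mathsf{b},\ldots$; a linear combination is $\mathsf{c}=\mathsf{n}_1+\cdots+\mathsf{n}_k$ ($k\ge0$). P-types: $F::=\alpha\mid D\multimap A\mid\forall\alpha.A$, linear p-types $A::=\S^{\mathsf c}F$, bang p-types $D::=\S^{\mathsf b,\mathsf c}F$. P-terms: $t::=x^D\mid\lambda x^D.t\mid(t)u\mid\Lambda\alpha.t\mid(t)A\mid\S^{\mathsf m}t$ ($D$ bang p-type, $A$ linear p-type, $\mathsf m$ integer parameter);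 erasure of p-terms/p-types forgets modalities and parameters. An instantiation $\phi=(\phi^b,\phi^i)$ maps boolean parameters to $\{0,1\}$ and integer parameters to $\mathbb Z$, extended additively to linear combinations. $\phi$ is admissible for a p-type $E$ if $\phi^i(\mathsf c)\ge0$ for every $\mathsf c$ in $E$ and, whenever $\S^{\mathsf b,\mathsf c}F$ occurs in $E$ with $\phi^b(\mathsf b)=1$, $\phi^i(\mathsf c)\ge1$. Then $\phi(E)$ replaces each $\S^{\mathsf c}F$, and each $\S^{\mathsf b,\mathsf c}F$ with $\phi^b(\mathsf b)=0$, by $\S^{\phi^i(\mathsf c)}\phi(F)$, and each $\S^{\mathsf b,\mathsf c}F$ with $\phi^b(\mathsf b)=1$ by $!\S^{\phi^i(\mathsf c)-1}\phi(F)$. $\phi$ is admissible for a p-term if admissible for all p-types in it; then $\phi(t)$ replaces each $\S^{\mathsf m}u$ by $\S^{\phi^i(\mathsf m)}u$, each $x^D$ by $x^{\phi(D)}$, each $(t)A$ by $(t)\phi(A)$. A linear (resp. bang) free decoration of an F type $T$ is a linear (resp. bang) p-type $E$ with $E^-=T$, every linear combination in $E$ a single integer parameter, and all parameters in $E$ mutually distinct. The free decoration $\widehat{M}$ (unique up to renaming of parameters): to each type $T$ of a variable $x^T$ of $M$ associate a bang free decoration $\widehat T$ (the same one for all occurrences of the same variable), to each type $U$ occurring as $(N)U$ a linear free decoration $\widehat U$, all these having pairwise disjoint parameter sets otherwise; then $\widehat{x^T}=\S^{\mathsf m}x^{\widehat T}$, $\widehat{\lambda x^T.M}=\S^{\mathsf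 m}\lambda x^{\widehat T}.\widehat M$, $\widehat{(M)N}=\S^{\mathsf m}((\widehat M)\widehat N)$, $\widehat{\Lambda\alpha.M}=\S^{\mathsf m}\Lambda\alpha.\widehat M$, $\widehat{(M)T}=\S^{\mathsf m}((\widehat M)\widehat T)$, each $\mathsf m$ a fresh integer parameter. -}

module Defs where

open import Data.Nat using (ℕ; zero; suc; _∸_)
open import Data.Integer using (ℤ; +_; -[1+_]; _≥_; _+_)
open import Data.Bool using (Bool; true; false)
open import Data.List using (List; []; _∷_; map; foldr)
open import Data.List.Relation.Unary.All using (All)
open import Data.Product using (Σ; _×_; _,_; proj₁; proj₂)
open import Data.Unit using (⊤)
open import Data.Empty using (⊥)
open import Relation.Binary.PropositionalEquality using (_≡_)

-- A variable occurrence x^T is `var v` where v points to the entry T of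
-- the context; the binder λx^T extends the context with T.

data Var {A : Set} : List A → Set where
  vz : ∀ {x xs} → Var (x ∷ xs)
  vs : ∀ {x xs} → Var xs → Var (x ∷ xs)

mapVar : ∀ {A B : Set} (f : A → B) {xs : List A} → Var xs → Var (map f xs)
mapVar f vz     = vz
mapVar f (vs v) = vs (mapVar f v)

-- type variables are names
TyVar : Set
TyVar = ℕ

data FType : Set where
  tv  : TyVar → FType
  _⇒_ : FType → FType → FType
  all : TyVar → FType → FType

data FTerm (Γ : List FType) : Set where
  var  : Var Γ → FTerm Γ
  lam  : (T : FType) → FTerm (T ∷ Γ) → FTerm Γ
  app  : FTerm Γ → FTerm Γ → FTerm Γ
  tlam : TyVar → FTerm Γ → FTerm Γ
  tapp : FTerm Γ → FType → FTerm Γ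

FTm : Set
FTm = Σ (List FType) FTerm

mutual
  data LTy : Set where
    tv  : TyVar → LTy
    _⊸_ : DTy → LTy → LTy
    all : TyVar → LTy → LTy
    §   : LTy → LTy

  data DTy : Set where
    lin : LTy → DTy
    !   : LTy → DTy

data PTerm (Δ : List DTy) : Set where
  var  : Var Δ → PTerm Δ
  lam  : (D : DTy) → PTerm (D ∷ Δ) → PTerm Δ
  app  : PTerm Δ → PTerm Δ → PTerm Δ
  tlam : TyVar → PTerm Δ → PTerm Δ
  tapp : PTerm Δ → LTy → PTerm Δ
  par  : PTerm Δ → PTerm Δ
  bar  : PTerm Δ → PTerm Δ

PTm : Set
PTm = Σ (List DTy) PTerm

iter : ∀ {A : Set} → ℕ → (A → A) → A → A
iter zero    f x = x
iter (suc n) f x = f (iter n f x)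

§ᵐ : ∀ {Δ} → ℤ → PTerm Δ → PTerm Δ
§ᵐ (+ n)     t = iter n par t
§ᵐ -[1+ n ]  t = iter (suc n) bar t

mutual
  eraseL : LTy → FType
  eraseL (tv α)  = tv α
  eraseL (D ⊸ A) = eraseD D ⇒ eraseL A
  eraseL (all α A) = all α (eraseL A)
  eraseL (§ A)   = eraseL A

  eraseD : DTy → FType
  eraseD (lin A) = eraseL A
  eraseD (! A)   = eraseL A

eraseT : ∀ {Δ} → PTerm Δ → FTerm (map eraseD Δ)
eraseT (var v)    = var (mapVar eraseD v)
eraseT (lam D t)  = lam (eraseD D) (eraseT t)
eraseT (app t u)  = app (eraseT t) (eraseT u)
eraseT (tlam α t) = tlam α (eraseT t)
eraseT (tapp t A) = tapp (eraseT t) (eraseL A)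
eraseT (par t)    = eraseT t
eraseT (bar t)    = eraseT t

erase : PTm → FTm
erase (Δ , t) = map eraseD Δ , eraseT t

notBar : ∀ {Δ} → PTerm Δ → Set
notBar (bar _) = ⊥
notBar _       = ⊤

notPar : ∀ {Δ} → PTerm Δ → Set
notPar (par _) = ⊥
notPar _       = ⊤

regularT : ∀ {Δ} → PTerm Δ → Set
regularT (var v)    = ⊤
regularT (lam D t)  = regularT t
regularT (app t u)  = regularT t × regularT u
regularT (tlam α t) = regularT t
regularT (tapp t A) = regularT t
regularT (par t)    = notBar t × regularT t
regularT (bar t)    = notPar t × regularT t

Regular : PTm → Set
Regular (Δ , t) = regularT t

-- Parameters, p-types and p-terms.
-- Integer parameters and boolean parameters are two separate sorts,
-- each indexed by ℕ.  A linear combination is a list of integer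
-- parameters (its sum).

LinComb : Set
LinComb = List ℕ

mutual
  data PF : Set where
    tv  : TyVar → PF
    _⊸_ : PD → PL → PF
    all : TyVar → PL → PF

  data PL : Set where
    §^ : LinComb → PF → PL

  data PD : Set where
    §^b : ℕ → LinComb → PF → PD

data PPTerm (Γ : List PD) : Set where
  var  : Var Γ → PPTerm Γ
  lam  : (D : PD) → PPTerm (D ∷ Γ) → PPTerm Γ
  app  : PPTerm Γ → PPTerm Γ → PPTerm Γ
  tlam : TyVar → PPTerm Γ → PPTerm Γ
  tapp : PPTerm Γ → PL → PPTerm Γ
  sec  : ℕ → PPTerm Γ → PPTerm Γ

PPTm : Set
PPTm = Σ (List PD) PPTerm

record Inst : Set where
  field
    φb : ℕ → Bool
    φi : ℕ → ℤ
open Inst public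

evalC : Inst → LinComb → ℤ
evalC φ c = foldr (λ m r → φi φ m + r) (+ 0) c

mutual
  admF : Inst → PF → Set
  admF φ (tv α)    = ⊤
  admF φ (D ⊸ A)   = admD φ D × admL φ A
  admF φ (all α A) = admL φ A

  admL : Inst → PL → Set
  admL φ (§^ c F) = (evalC φ c ≥ + 0) × admF φ F

  admD : Inst → PD → Set
  admD φ (§^b b c F) =
    (evalC φ c ≥ + 0) × (φb φ b ≡ true → evalC φ c ≥ + 1) × admF φ F

admT : ∀ {Γ} → Inst → PPTerm Γ → Set
admT φ (var v)    = ⊤
admT φ (lam D t)  = admD φ D × admT φ t
admT φ (app t u)  = admT φ t × admT φ u
admT φ (tlam α t) = admT φ t
admT φ (tapp t A) = admT φ t × admL φ A
admT φ (sec m t)  = admT φ t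

Admissible : Inst → PPTm → Set
Admissible φ (Γ , t) = All (admD φ) Γ × admT φ t

-- nonnegative part of an integer (only used where admissibility
-- guarantees nonnegativity)
natOf : ℤ → ℕ
natOf (+ n)      = n
natOf -[1+ n ]   = 0

§ⁿ : ℕ → LTy → LTy
§ⁿ n A = iter n § A

mutual
  instF : Inst → PF → LTy
  instF φ (tv α)    = tv α
  instF φ (D ⊸ A)   = instD φ D ⊸ instL φ A
  instF φ (all α A) = all α (instL φ A)

  instL : Inst → PL → LTy
  instL φ (§^ c F) = §ⁿ (natOf (evalC φ c)) (instF φ F)

  instD : Inst → PD → DTy
  instD φ (§^b b c F) = instDb (φb φ b)
    where
      instDb : Bool → DTy
      instDb false = lin (§ⁿ (natOf (evalC φ c)) (instF φ F))
      instDb true  = ! (§ⁿ (natOf (evalC φ c) ∸ 1) (instF φ F))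

instT : ∀ {Γ} → (φ : Inst) → PPTerm Γ → PTerm (map (instD φ) Γ)
instT φ (var v)    = var (mapVar (instD φ) v)
instT φ (lam D t)  = lam (instD φ D) (instT φ t)
instT φ (app t u)  = app (instT φ t) (instT φ u)
instT φ (tlam α t) = tlam α (instT φ t)
instT φ (tapp t A) = tapp (instT φ t) (instL φ A)
instT φ (sec m t)  = §ᵐ (φi φ m) (instT φ t)

inst : Inst → PPTm → PTm
inst φ (Γ , t) = map (instD φ) Γ , instT φ t

-- Free decoration (a concrete choice of fresh parameters, threaded by
-- a counter; every parameter used is strictly below the returned counter
-- and at least the input counter, so all parameters are distinct).

mutual
  fdF : FType → ℕ → PF × ℕ
  fdF (tv α) n = tv α , n
  fdF (T ⇒ U) n =
    let (D , n₁) = fdB T n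
        (A , n₂) = fdL U n₁
    in (D ⊸ A) , n₂
  fdF (all α T) n =
    let (A , n₁) = fdL T n in all α A , n₁

  fdL : FType → ℕ → PL × ℕ
  fdL T n = let (F , n₁) = fdF T (suc n) in §^ (n ∷ []) F , n₁

  fdB : FType → ℕ → PD × ℕ
  fdB T n = let (F , n₁) = fdF T (suc (suc n)) in §^b n (suc n ∷ []) F , n₁

ext : ∀ {A B : Set} {Γ : List A} {Γ' : List B} {x : A} {y : B} →
      (Var Γ → Var Γ') → Var (x ∷ Γ) → Var (y ∷ Γ')
ext ρ vz     = vz
ext ρ (vs v) = vs (ρ v)

fdCtx : (Γ : List FType) → ℕ → Σ (List PD) (λ Γ̂ → Var Γ → Var Γ̂) × ℕ
fdCtx [] n = ([] , λ ()) , n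
fdCtx (T ∷ Γ) n =
  let (D , n₁) = fdB T n
      ((Γ̂ , ρ) , n₂) = fdCtx Γ n₁
  in (D ∷ Γ̂ , ext ρ) , n₂

fdT : ∀ {Γ Γ̂} → FTerm Γ → (Var Γ → Var Γ̂) → ℕ → PPTerm Γ̂ × ℕ
fdT (var v) ρ n = sec n (var (ρ v)) , suc n
fdT (lam T M) ρ n =
  let (D , n₁) = fdB T (suc n)
      (t , n₂) = fdT M (ext ρ) n₁
  in sec n (lam D t) , n₂
fdT (app M N) ρ n =
  let (u , n₁) = fdT M ρ (suc n)
      (w , n₂) = fdT N ρ n₁
  in sec n (app u w) , n₂
fdT (tlam α M) ρ n =
  let (u , n₁) = fdT M ρ (suc n) in sec n (tlam α u) , n₁
fdT (tapp M T) ρ n =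
  let (u , n₁) = fdT M ρ (suc n)
      (A , n₂) = fdL T n₁
  in sec n (tapp u A) , n₂

freeDec : FTm → PPTm
freeDec (Γ , M) =
  let ((Γ̂ , ρ) , n₁) = fdCtx Γ 0
  in Γ̂ , proj₁ (fdT M ρ n₁)

{-# OPTIONS --safe #-}
module Submission where

-- Instantiation only changes modalities, so erasing an instance of the free decoration of M
-- gives back M.  Conversely, let t be a regular decoration of M.  Every node of t sits under
-- a block of modalities that, by regularity, is either §^k or §̄^k, i.e. §^z for one integer z;
-- the fresh parameter the free decoration puts at that node is set to z.  In a type, a block
-- §^k in front of a non-§ type fixes the integer parameter to k (or k + 1 under !) and the
-- presence of ! fixes the boolean parameter.  Since the free decoration draws its parameters
-- from a counter, each subterm uses an interval of parameters disjoint from those of its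
-- siblings, so these local choices glue together into one instantiation.

open import Defs
open import Data.Bool using (Bool; true; false; if_then_else_)
open import Data.Integer using (ℤ; +_; -[1+_]; _≥_; +≤+)
open import Data.Integer.Properties using (+-identityʳ)
open import Data.List using (List; []; _∷_; map)
open import Data.List.Relation.Unary.All using (All; []; _∷_)
open import Data.Nat using (ℕ; zero; suc; _≤_; _<_; _∸_; z≤n; s≤s; _<ᵇ_)
open import Data.Nat.Properties using (≤-refl; ≤-trans; <-≤-trans; n≤1+n; n<1+n; ≤⇒≯; <⇒<ᵇ; <ᵇ⇒<; suc-injective)
open import Data.Product using (Σ; _×_; _,_; proj₁; proj₂; map₂)
open import Data.Unit using (⊤; tt)
open import Function.Bundles using (_⇔_; mk⇔)
open import Relation.Nullary using (contradiction)
open import Relation.Binary.PropositionalEquality using (_≡_; refl; sym; trans; cong; cong₂; subst)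

index : ∀ {A : Set} {xs : List A} → Var xs → ℕ
index vz     = zero
index (vs v) = suc (index v)

index-injective : ∀ {A : Set} {xs : List A} {v w : Var xs} → index v ≡ index w → v ≡ w
index-injective {v = vz}   {w = vz}   _  = refl
index-injective {v = vs v} {w = vs w} e  = cong vs (index-injective (suc-injective e))
index-injective {v = vz}   {w = vs w} ()
index-injective {v = vs v} {w = vz}   ()

index-mapVar : ∀ {A B : Set} (f : A → B) {xs : List A} (v : Var xs) → index (mapVar f v) ≡ index v
index-mapVar f vz     = refl
index-mapVar f (vs v) = cong suc (index-mapVar f v)

IndexPreserving : ∀ {A B : Set} {xs : List A} {ys : List B} → (Var xs → Var ys) → Set
IndexPreserving ρ = ∀ v → index (ρ v) ≡ index v

ext-index : ∀ {A B : Set} {xs : List A} {ys : List B} {x : A} {y : B} {ρ : Var xs → Var ys} →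
            IndexPreserving ρ → IndexPreserving (ext {x = x} {y = y} ρ)
ext-index ρ-index vz     = refl
ext-index ρ-index (vs v) = cong suc (ρ-index v)

-- Terms whose contexts are only propositionally equal are compared as pairs (context , term),
-- and variables by their de Bruijn index.
module _ {X : Set} {F : List X → Set} where

  private
    Scoped : Set
    Scoped = Σ (List X) F

  cong-var : (c : ∀ {Γ} → Var Γ → F Γ) {Γ₁ Γ₂ : List X} {v : Var Γ₁} {w : Var Γ₂} →
             Γ₁ ≡ Γ₂ → index v ≡ index w → _≡_ {A = Scoped} (Γ₁ , c v) (Γ₂ , c w)
  cong-var c refl e = cong (λ v → _ , c v) (index-injective e)

  cong-bind : (c : ∀ {Γ} (x : X) → F (x ∷ Γ) → F Γ) {x₁ x₂ : X} {Γ₁ Γ₂ : List X}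
              {a₁ : F (x₁ ∷ Γ₁)} {a₂ : F (x₂ ∷ Γ₂)} →
              _≡_ {A = Scoped} (x₁ ∷ Γ₁ , a₁) (x₂ ∷ Γ₂ , a₂) →
              _≡_ {A = Scoped} (Γ₁ , c x₁ a₁) (Γ₂ , c x₂ a₂)
  cong-bind c refl = refl

  cong-op₂ : (c : ∀ {Γ} → F Γ → F Γ → F Γ) {Γ₁ Γ₂ : List X} {a₁ b₁ : F Γ₁} {a₂ b₂ : F Γ₂} →
             _≡_ {A = Scoped} (Γ₁ , a₁) (Γ₂ , a₂) → _≡_ {A = Scoped} (Γ₁ , b₁) (Γ₂ , b₂) →
             _≡_ {A = Scoped} (Γ₁ , c a₁ b₁) (Γ₂ , c a₂ b₂)
  cong-op₂ c refl refl = refl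

iter-invariant : ∀ {A B : Set} (g : A → B) {f : A → A} → (∀ x → g (f x) ≡ g x) →
                 ∀ n x → g (iter n f x) ≡ g x
iter-invariant g         inv zero    x = refl
iter-invariant g {f} inv (suc n) x = trans (inv (iter n f x)) (iter-invariant g inv n x)

iter-suc : ∀ {A : Set} (f : A → A) n x → iter (suc n) f x ≡ iter n f (f x)
iter-suc f zero    x = refl
iter-suc f (suc n) x = cong f (iter-suc f n x)

eraseT-§ᵐ : ∀ {Δ} z (t : PTerm Δ) → eraseT (§ᵐ z t) ≡ eraseT t
eraseT-§ᵐ (+ n)    = iter-invariant eraseT {par} (λ _ → refl) n
eraseT-§ᵐ -[1+ n ] = iter-invariant eraseT {bar} (λ _ → refl) (suc n)

eraseL-§ⁿ : ∀ k A → eraseL (§ⁿ k A) ≡ eraseL A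
eraseL-§ⁿ = iter-invariant eraseL (λ _ → refl)

eraseL-instL : ∀ φ c F → eraseL (instL φ (§^ c F)) ≡ eraseL (instF φ F)
eraseL-instL φ c F = eraseL-§ⁿ (natOf (evalC φ c)) (instF φ F)

eraseD-instD : ∀ φ b c F → eraseD (instD φ (§^b b c F)) ≡ eraseL (instF φ F)
eraseD-instD φ b c F with φb φ b
... | false = eraseL-§ⁿ (natOf (evalC φ c)) (instF φ F)
... | true  = eraseL-§ⁿ (natOf (evalC φ c) ∸ 1) (instF φ F)

mutual
  eraseL-inst-fdF : ∀ φ T n → eraseL (instF φ (proj₁ (fdF T n))) ≡ T
  eraseL-inst-fdF φ (tv α)    n = refl
  eraseL-inst-fdF φ (T ⇒ U)   n = cong₂ _⇒_ (eraseD-inst-fdB φ T n) (eraseL-inst-fdL φ U _)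
  eraseL-inst-fdF φ (all α T) n = cong (all α) (eraseL-inst-fdL φ T n)

  eraseL-inst-fdL : ∀ φ T n → eraseL (instL φ (proj₁ (fdL T n))) ≡ T
  eraseL-inst-fdL φ T n = trans (eraseL-instL φ (n ∷ []) _) (eraseL-inst-fdF φ T (suc n))

  eraseD-inst-fdB : ∀ φ T n → eraseD (instD φ (proj₁ (fdB T n))) ≡ T
  eraseD-inst-fdB φ T n = trans (eraseD-instD φ n (suc n ∷ []) _) (eraseL-inst-fdF φ T (suc (suc n)))

eraseD-inst-fdCtx : ∀ φ Γ n → map eraseD (map (instD φ) (proj₁ (proj₁ (fdCtx Γ n)))) ≡ Γ
eraseD-inst-fdCtx φ []      n = refl
eraseD-inst-fdCtx φ (T ∷ Γ) n = cong₂ _∷_ (eraseD-inst-fdB φ T n) (eraseD-inst-fdCtx φ Γ _)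

fdCtx-index : ∀ Γ n → IndexPreserving (proj₂ (proj₁ (fdCtx Γ n)))
fdCtx-index []      n ()
fdCtx-index (T ∷ Γ) n = ext-index (fdCtx-index Γ _)

erase-§ᵐ : ∀ {Δ} z {t : PTerm Δ} {M : FTm} → (map eraseD Δ , eraseT t) ≡ M →
           (map eraseD Δ , eraseT (§ᵐ z t)) ≡ M
erase-§ᵐ z {t} = trans (cong (_ ,_) (eraseT-§ᵐ z t))

eraseT-inst-fdT : ∀ φ {Γ Γ̂} (M : FTerm Γ) {ρ : Var Γ → Var Γ̂} → IndexPreserving ρ →
                  map eraseD (map (instD φ) Γ̂) ≡ Γ → ∀ n →
                  _≡_ {A = FTm} (map eraseD (map (instD φ) Γ̂) , eraseT (instT φ (proj₁ (fdT M ρ n))))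
                                (Γ , M)
eraseT-inst-fdT φ (var v) {ρ} ρ-index eΓ n =
  erase-§ᵐ (φi φ n) (cong-var var eΓ (trans (index-mapVar eraseD _)
                                     (trans (index-mapVar (instD φ) (ρ v)) (ρ-index v))))
eraseT-inst-fdT φ (lam T M) ρ-index eΓ n =
  erase-§ᵐ (φi φ n) (cong-bind lam (eraseT-inst-fdT φ M (ext-index ρ-index)
                                      (cong₂ _∷_ (eraseD-inst-fdB φ T (suc n)) eΓ) _))
eraseT-inst-fdT φ (app M N) ρ-index eΓ n =
  erase-§ᵐ (φi φ n) (cong-op₂ app (eraseT-inst-fdT φ M ρ-index eΓ (suc n))
                                  (eraseT-inst-fdT φ N ρ-index eΓ _))
eraseT-inst-fdT φ (tlam α M) ρ-index eΓ n =
  erase-§ᵐ (φi φ n) (cong (map₂ (tlam α)) (eraseT-inst-fdT φ M ρ-index eΓ (suc n)))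
eraseT-inst-fdT φ (tapp M T) ρ-index eΓ n =
  erase-§ᵐ (φi φ n) (cong₂ (λ p U → map₂ (λ N → tapp N U) p)
                           (eraseT-inst-fdT φ M ρ-index eΓ (suc n)) (eraseL-inst-fdL φ T _))

erase-inst-freeDec : ∀ M φ → erase (inst φ (freeDec M)) ≡ M
erase-inst-freeDec (Γ , M) φ = eraseT-inst-fdT φ M (fdCtx-index Γ 0) (eraseD-inst-fdCtx φ Γ 0) _

param : Inst → ℕ → Bool × ℤ
param φ k = φb φ k , φi φ k

fromParams : (ℕ → Bool × ℤ) → Inst
fromParams f = record { φb = λ k → proj₁ (f k) ; φi = λ k → proj₂ (f k) }

Agree : Inst → Inst → ℕ → ℕ → Set
Agree φ ψ lo hi = ∀ {k} → lo ≤ k → k < hi → param φ k ≡ param ψ k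

record Realisable (lo hi : ℕ) (P : Inst → Set) : Set where
  field
    lo≤hi   : lo ≤ hi
    witness : Inst
    sound   : ∀ {φ} → Agree φ witness lo hi → P φ
open Realisable

realise : ∀ {lo hi P} → Realisable lo hi P → Σ Inst P
realise r = witness r , sound r (λ _ _ → refl)

always : ∀ {n} {P : Inst → Set} → (∀ {φ} → P φ) → Realisable n n P
always p = record { lo≤hi = ≤-refl ; witness = fromParams (λ _ → false , + 0) ; sound = λ _ → p }

fixInt : ∀ n z → Realisable n (suc n) (λ φ → φi φ n ≡ z)
fixInt n z = record
  { lo≤hi   = n≤1+n n
  ; witness = fromParams (λ _ → false , z)
  ; sound   = λ agree → cong proj₂ (agree ≤-refl (n<1+n n))
  }

fixBool : ∀ n b → Realisable n (suc n) (λ φ → φb φ n ≡ b)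
fixBool n b = record
  { lo≤hi   = n≤1+n n
  ; witness = fromParams (λ _ → b , + 0)
  ; sound   = λ agree → cong proj₁ (agree ≤-refl (n<1+n n))
  }

glue : ℕ → Inst → Inst → Inst
glue mid ψ₁ ψ₂ = fromParams (λ k → if k <ᵇ mid then param ψ₁ k else param ψ₂ k)

glue-below : ∀ {mid k} ψ₁ ψ₂ → k < mid → param (glue mid ψ₁ ψ₂) k ≡ param ψ₁ k
glue-below {mid} {k} ψ₁ ψ₂ k<mid with k <ᵇ mid | <⇒<ᵇ k<mid
... | true  | _ = refl
... | false | ()

glue-above : ∀ {mid k} ψ₁ ψ₂ → mid ≤ k → param (glue mid ψ₁ ψ₂) k ≡ param ψ₂ k
glue-above {mid} {k} ψ₁ ψ₂ mid≤k with k <ᵇ mid | <ᵇ⇒< k mid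
... | true  | k<mid = contradiction (k<mid _) (≤⇒≯ mid≤k)
... | false | _     = refl

infixr 5 _⊗_
infixr 4 _<$>_

_⊗_ : ∀ {lo mid hi P Q} → Realisable lo mid P → Realisable mid hi Q →
      Realisable lo hi (λ φ → P φ × Q φ)
_⊗_ {lo} {mid} {hi} r s = record
  { lo≤hi   = ≤-trans (lo≤hi r) (lo≤hi s)
  ; witness = ψ
  ; sound   = λ agree → sound r (below agree) , sound s (above agree)
  }
  where
    ψ : Inst
    ψ = glue mid (witness r) (witness s)

    below : ∀ {φ} → Agree φ ψ lo hi → Agree φ (witness r) lo mid
    below agree lo≤k k<mid =
      trans (agree lo≤k (<-≤-trans k<mid (lo≤hi s))) (glue-below (witness r) (witness s) k<mid)

    above : ∀ {φ} → Agree φ ψ lo hi → Agree φ (witness s) mid hi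
    above agree mid≤k k<hi =
      trans (agree (≤-trans (lo≤hi r) mid≤k) k<hi) (glue-above (witness r) (witness s) mid≤k)

_<$>_ : ∀ {lo hi} {P Q : Inst → Set} → (∀ {φ} → P φ → Q φ) → Realisable lo hi P → Realisable lo hi Q
f <$> r = record { lo≤hi = lo≤hi r ; witness = witness r ; sound = λ agree → f (sound r agree) }

outer§ : LTy → ℕ
outer§ (§ A) = suc (outer§ A)
outer§ _     = zero

evalC-singleton : ∀ φ m → evalC φ (m ∷ []) ≡ φi φ m
evalC-singleton φ m = +-identityʳ (φi φ m)

evalC-singleton-≥ : ∀ φ m {k} → φi φ m ≡ + k → evalC φ (m ∷ []) ≥ + 0
evalC-singleton-≥ φ m e rewrite evalC-singleton φ m | e = +≤+ z≤n

evalC-singleton-> : ∀ φ m {k} → φi φ m ≡ + suc k → evalC φ (m ∷ []) ≥ + 1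
evalC-singleton-> φ m e rewrite evalC-singleton φ m | e = +≤+ (s≤s z≤n)

instL-singleton : ∀ φ m F {k} → φi φ m ≡ + k → instL φ (§^ (m ∷ []) F) ≡ §ⁿ k (instF φ F)
instL-singleton φ m F e rewrite evalC-singleton φ m | e = refl

instD-lin-singleton : ∀ φ b m F {k} → φb φ b ≡ false → φi φ m ≡ + k →
                      instD φ (§^b b (m ∷ []) F) ≡ lin (§ⁿ k (instF φ F))
instD-lin-singleton φ b m F eb e rewrite eb | evalC-singleton φ m | e = refl

instD-!-singleton : ∀ φ b m F {k} → φb φ b ≡ true → φi φ m ≡ + suc k →
                    instD φ (§^b b (m ∷ []) F) ≡ ! (§ⁿ k (instF φ F))
instD-!-singleton φ b m F eb e rewrite eb | evalC-singleton φ m | e = refl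

mutual
  fdF-instantiable : ∀ A n → Realisable n (proj₂ (fdF (eraseL A) n))
                       (λ φ → §ⁿ (outer§ A) (instF φ (proj₁ (fdF (eraseL A) n))) ≡ A
                              × admF φ (proj₁ (fdF (eraseL A) n)))
  fdF-instantiable (tv α) n = always (refl , tt)
  fdF-instantiable (D ⊸ A) n =
    (λ ((eD , aD) , (eA , aA)) → cong₂ _⊸_ eD eA , aD , aA)
    <$> fdB-instantiable D n ⊗ fdL-instantiable A _
  fdF-instantiable (all α A) n = (λ (eA , aA) → cong (all α) eA , aA) <$> fdL-instantiable A n
  fdF-instantiable (§ A)     n = (λ (e , a) → cong § e , a) <$> fdF-instantiable A n

  fdL-instantiable : ∀ A n → Realisable n (proj₂ (fdL (eraseL A) n))
                       (λ φ → instL φ (proj₁ (fdL (eraseL A) n)) ≡ A × admL φ (proj₁ (fdL (eraseL A) n)))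
  fdL-instantiable A n =
    (λ {φ} (e , eF , aF) → trans (instL-singleton φ n _ e) eF , evalC-singleton-≥ φ n e , aF)
    <$> fixInt n (+ outer§ A) ⊗ fdF-instantiable A (suc n)

  fdB-instantiable : ∀ D n → Realisable n (proj₂ (fdB (eraseD D) n))
                       (λ φ → instD φ (proj₁ (fdB (eraseD D) n)) ≡ D × admD φ (proj₁ (fdB (eraseD D) n)))
  fdB-instantiable (lin A) n =
    (λ {φ} (eb , e , eF , aF) →
       trans (instD-lin-singleton φ n (suc n) _ eb e) (cong lin eF) ,
       evalC-singleton-≥ φ (suc n) e , (λ b≡true → contradiction (trans (sym eb) b≡true) λ ()) , aF)
    <$> fixBool n false ⊗ fixInt (suc n) (+ outer§ A) ⊗ fdF-instantiable A (suc (suc n))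
  fdB-instantiable (! A) n =
    (λ {φ} (eb , e , eF , aF) →
       trans (instD-!-singleton φ n (suc n) _ eb e) (cong ! eF) ,
       evalC-singleton-≥ φ (suc n) e , (λ _ → evalC-singleton-> φ (suc n) e) , aF)
    <$> fixBool n true ⊗ fixInt (suc n) (+ suc (outer§ A)) ⊗ fdF-instantiable A (suc (suc n))

fdCtx-instantiable : ∀ Δ n → Realisable n (proj₂ (fdCtx (map eraseD Δ) n))
                (λ φ → map (instD φ) (proj₁ (proj₁ (fdCtx (map eraseD Δ) n))) ≡ Δ
                       × All (admD φ) (proj₁ (proj₁ (fdCtx (map eraseD Δ) n))))
fdCtx-instantiable []      n = always (refl , [])
fdCtx-instantiable (D ∷ Δ) n = (λ ((eD , aD) , (eΔ , aΔ)) → cong₂ _∷_ eD eΔ , aD ∷ aΔ)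
                        <$> fdB-instantiable D n ⊗ fdCtx-instantiable Δ _

NoCancellation : ∀ {Δ} → ℤ → PTerm Δ → Set
NoCancellation (+ zero)  t = ⊤
NoCancellation (+ suc _) t = notBar t
NoCancellation -[1+ _ ]  t = notPar t

record Instantiates {Γ̂ Δ} (φ : Inst) (t̂ : PPTerm Γ̂) (t : PTerm Δ) : Set where
  constructor instantiates
  field
    inst-≡     : map (instD φ) Γ̂ ≡ Δ → _≡_ {A = PTm} (map (instD φ) Γ̂ , instT φ t̂) (Δ , t)
    admissible : admT φ t̂

retarget : ∀ {lo hi Γ̂ Δ} {t̂ : PPTerm Γ̂} {t₁ t₂ : PTerm Δ} → t₁ ≡ t₂ →
           Realisable lo hi (λ φ → Instantiates φ t̂ t₁) → Realisable lo hi (λ φ → Instantiates φ t̂ t₂)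
retarget e r = subst (Instantiates _ _) e <$> r

cong-§ᵐ : ∀ {z₁ z₂} {p₁ p₂ : PTm} → z₁ ≡ z₂ → p₁ ≡ p₂ → map₂ (§ᵐ z₁) p₁ ≡ map₂ (§ᵐ z₂) p₂
cong-§ᵐ refl refl = refl

-- z is the block of modalities §^z already peeled off above t.
fdT-instantiable : ∀ {Δ Γ̂} (t : PTerm Δ) → regularT t → ∀ z → NoCancellation z t →
            {ρ : Var (map eraseD Δ) → Var Γ̂} → IndexPreserving ρ → ∀ n →
            Realisable n (proj₂ (fdT (eraseT t) ρ n))
                       (λ φ → Instantiates φ (proj₁ (fdT (eraseT t) ρ n)) (§ᵐ z t))
fdT-instantiable (par t) (nb , reg) (+ m) _ ρ-index n =
  retarget (iter-suc par m t) (fdT-instantiable t reg (+ suc m) nb ρ-index n)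
fdT-instantiable (par t) _ -[1+ m ] ()
fdT-instantiable (bar t) (np , reg) (+ zero) _ ρ-index n =
  fdT-instantiable t reg -[1+ 0 ] np ρ-index n
fdT-instantiable (bar t) _ (+ suc m) ()
fdT-instantiable (bar t) (np , reg) -[1+ m ] _ ρ-index n =
  retarget (cong bar (iter-suc bar m t)) (fdT-instantiable t reg -[1+ suc m ] np ρ-index n)
fdT-instantiable (var v) _ z _ {ρ} ρ-index n =
  (λ {φ} e → instantiates (λ eΓ → cong-§ᵐ e (cong-var var eΓ (index-chain φ))) tt)
  <$> fixInt n z
  where
    index-chain : ∀ φ → index (mapVar (instD φ) (ρ (mapVar eraseD v))) ≡ index v
    index-chain φ = trans (index-mapVar (instD φ) _) (trans (ρ-index _) (index-mapVar eraseD v))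
fdT-instantiable (lam D s) reg z _ ρ-index n =
  (λ (e , (eD , aD) , instantiates es as) →
     instantiates (λ eΓ → cong-§ᵐ e (cong-bind lam (es (cong₂ _∷_ eD eΓ)))) (aD , as))
  <$> fixInt n z ⊗ fdB-instantiable D (suc n)
                 ⊗ fdT-instantiable s reg (+ 0) tt (ext-index ρ-index) _
fdT-instantiable (app s u) (reg-s , reg-u) z _ ρ-index n =
  (λ (e , instantiates es as , instantiates eu au) →
     instantiates (λ eΓ → cong-§ᵐ e (cong-op₂ app (es eΓ) (eu eΓ))) (as , au))
  <$> fixInt n z ⊗ fdT-instantiable s reg-s (+ 0) tt ρ-index (suc n)
                 ⊗ fdT-instantiable u reg-u (+ 0) tt ρ-index _
fdT-instantiable (tlam α s) reg z _ ρ-index n =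
  (λ (e , instantiates es as) → instantiates (λ eΓ → cong-§ᵐ e (cong (map₂ (tlam α)) (es eΓ))) as)
  <$> fixInt n z ⊗ fdT-instantiable s reg (+ 0) tt ρ-index (suc n)
fdT-instantiable (tapp s A) reg z _ ρ-index n =
  (λ (e , instantiates es as , (eA , aA)) →
     instantiates (λ eΓ → cong-§ᵐ e (cong₂ (λ p B → map₂ (λ u → tapp u B) p) (es eΓ) eA)) (as , aA))
  <$> fixInt n z ⊗ fdT-instantiable s reg (+ 0) tt ρ-index (suc n) ⊗ fdL-instantiable A _

FreeInstance : FTm → PTm → Set
FreeInstance M t = Σ Inst (λ φ → Admissible φ (freeDec M) × inst φ (freeDec M) ≡ t)

regular⇒free-instance : ∀ t → Regular t → FreeInstance (erase t) t
regular⇒free-instance (Δ , t) reg =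
  let φ , (eΔ , aΔ) , instantiates et at =
        realise (fdCtx-instantiable Δ 0
                 ⊗ fdT-instantiable t reg (+ 0) tt (fdCtx-index (map eraseD Δ) 0) _)
  in φ , (aΔ , at) , et eΔ

lemma2 : (M : FTm) (t : PTm) → Regular t →
         (erase t ≡ M) ⇔ Σ Inst (λ φ → Admissible φ (freeDec M) × inst φ (freeDec M) ≡ t)
lemma2 M t reg =
  mk⇔ (λ e → subst (λ M → FreeInstance M t) e (regular⇒free-instance t reg))
      (λ (φ , _ , e) → trans (cong erase (sym e)) (erase-inst-freeDec M φ))
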